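{- Assume univalence and set replacement. For a \(\mathcal V\)-dcpo \(D\), the type of specified small compact bases for \(D\), namely \(\Sigma_{B:\mathcal V}\Sigma_{\beta:B\to D}(\beta \text{ is a small compact basis for } D)\), and its propositional truncation (\(D\) has an unspecified small compact basis) are logically equivalent.
   Context: We work constructively and predicatively in univalent foundations with universes and propositional truncation. A type \(X\) is \(\mathcal V\)-small if it is equivalent to a type in \(\mathcal V\); a type is locally \(\mathcal V\)-small if all its identity types are \(\mathcal V\)-small. Set replacement: for any map \(f:X\to Y\) with \(X\) \(\mathcal U\)-small and \(Y\) a locally \(\mathcal V\)-small set, the image of \(f\) is \((\mathcal U\sqcup\mathcal V)\)-small. Directed family: inhabited index and any two indices have (there exists) a common upper index. \(\mathcal V\)-dcpo: poset (set carrier, proposition-valued order) with suprema of directed families indexed by types in \(\mathcal V\). Way-below: \(x\ll y\) iff for every directed \(\alpha:I\to D\), \(I:\mathcal V\), with \(y\sqsubseteq\bigsqcup\alpha\) there exists \(i\) with \(x\sqsubseteq\alpha_i\); compact: \(x\ll x\). Small compact basis: a map \(\beta:B\to D\) with \(B:\mathcal V\) such that each \(\beta(b)\) is compact, for every \(x:D\) the family \(\Sigma_{b:B}(\beta(b)\sqsubseteq x)\to D\), \((b,-)\mapsto\beta(b)\), is directed with supremum \(x\), and each proposition \(\beta(b)\sqsubseteq x\) is \(\mathcal V\)-small. Logically equivalent: there are maps in both directions. -}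

{-# OPTIONS --without-K #-}
module Defs where

open import Agda.Primitive using (Level; lzero; lsuc; _⊔_; Setω)
open import Data.Product using (Σ; Σ-syntax; _×_; _,_; proj₁; proj₂)
open import Relation.Binary.PropositionalEquality using (_≡_; refl)

is-prop : ∀ {ℓ} → Set ℓ → Set ℓ
is-prop X = (x y : X) → x ≡ y

is-set : ∀ {ℓ} → Set ℓ → Set ℓ
is-set X = (x y : X) → is-prop (x ≡ y)

is-equiv : ∀ {a b} {A : Set a} {B : Set b} → (A → B) → Set (a ⊔ b)
is-equiv {A = A} {B} f =
  (Σ[ g ∈ (B → A) ] ((y : B) → f (g y) ≡ y)) ×
  (Σ[ h ∈ (B → A) ] ((x : A) → h (f x) ≡ x))

_≃_ : ∀ {a b} → Set a → Set b → Set (a ⊔ b)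
A ≃ B = Σ[ f ∈ (A → B) ] is-equiv f

id-≃ : ∀ {a} (A : Set a) → A ≃ A
id-≃ A = (λ x → x) , ((λ x → x) , λ _ → refl) , ((λ x → x) , λ _ → refl)

idtoeqv : ∀ {ℓ} {A B : Set ℓ} → A ≡ B → A ≃ B
idtoeqv {A = A} refl = id-≃ A

is-univalent : (ℓ : Level) → Set (lsuc ℓ)
is-univalent ℓ = (A B : Set ℓ) → is-equiv (idtoeqv {ℓ} {A} {B})

Univalence : Setω
Univalence = ∀ {ℓ} → is-univalent ℓ

is-small : ∀ {ℓ} → Set ℓ → (𝓥 : Level) → Set (ℓ ⊔ lsuc 𝓥)
is-small X 𝓥 = Σ[ Y ∈ Set 𝓥 ] (Y ≃ X)

is-locally-small : ∀ {ℓ} → Set ℓ → (𝓥 : Level) → Set (ℓ ⊔ lsuc 𝓥)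
is-locally-small X 𝓥 = (x y : X) → is-small (x ≡ y) 𝓥

_↔_ : ∀ {a b} → Set a → Set b → Set (a ⊔ b)
A ↔ B = (A → B) × (B → A)

record PropTrunc : Setω where
  field
    ∥_∥ : ∀ {ℓ} → Set ℓ → Set ℓ
    ∥∥-is-prop : ∀ {ℓ} {X : Set ℓ} → is-prop ∥ X ∥
    ∣_∣ : ∀ {ℓ} {X : Set ℓ} → X → ∥ X ∥
    ∥∥-rec : ∀ {ℓ ℓ'} {X : Set ℓ} {P : Set ℓ'} → is-prop P → (X → P) → ∥ X ∥ → P

module _ (pt : PropTrunc) where
  open PropTrunc pt

  ∃∥ : ∀ {a b} {A : Set a} → (A → Set b) → Set (a ⊔ b)
  ∃∥ {A = A} P = ∥ Σ A P ∥

  image : ∀ {a b} {X : Set a} {Y : Set b} → (X → Y) → Set (a ⊔ b)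
  image {X = X} {Y} f = Σ[ y ∈ Y ] ∥ Σ[ x ∈ X ] (f x ≡ y) ∥

  SetReplacement : Setω
  SetReplacement = ∀ {𝓤 𝓥 a b} {X : Set a} {Y : Set b} (f : X → Y)
    → is-small X 𝓤 → is-locally-small Y 𝓥 → is-set Y
    → is-small (image f) (𝓤 ⊔ 𝓥)

  module _ {𝓤 𝓣 : Level} {D : Set 𝓤} (_⊑_ : D → D → Set 𝓣) where

    is-directed : ∀ {𝓥} {I : Set 𝓥} → (I → D) → Set (𝓥 ⊔ 𝓣)
    is-directed {I = I} α =
      ∥ I ∥ × ((i j : I) → ∥ Σ[ k ∈ I ] ((α i ⊑ α k) × (α j ⊑ α k)) ∥)

    is-upperbound : ∀ {𝓥} {I : Set 𝓥} → D → (I → D) → Set (𝓥 ⊔ 𝓣)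
    is-upperbound {I = I} u α = (i : I) → α i ⊑ u

    is-sup : ∀ {𝓥} {I : Set 𝓥} → D → (I → D) → Set (𝓥 ⊔ 𝓤 ⊔ 𝓣)
    is-sup s α = is-upperbound s α × ((u : D) → is-upperbound u α → s ⊑ u)

  record DCPO (𝓥 𝓤 𝓣 : Level) : Set (lsuc 𝓥 ⊔ lsuc 𝓤 ⊔ lsuc 𝓣) where
    field
      ⟨_⟩ : Set 𝓤
      _⊑_ : ⟨_⟩ → ⟨_⟩ → Set 𝓣
      carrier-is-set : is-set ⟨_⟩
      ⊑-prop-valued : (x y : ⟨_⟩) → is-prop (x ⊑ y)
      ⊑-refl : (x : ⟨_⟩) → x ⊑ x
      ⊑-trans : (x y z : ⟨_⟩) → x ⊑ y → y ⊑ z → x ⊑ z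
      ⊑-antisym : (x y : ⟨_⟩) → x ⊑ y → y ⊑ x → x ≡ y
      ∐ : {I : Set 𝓥} (α : I → ⟨_⟩) → is-directed _⊑_ α → ⟨_⟩
      ∐-is-sup : {I : Set 𝓥} (α : I → ⟨_⟩) (δ : is-directed _⊑_ α)
               → is-sup _⊑_ (∐ α δ) α

  module _ {𝓥 𝓤 𝓣 : Level} (D : DCPO 𝓥 𝓤 𝓣) where
    open DCPO D

    _≪_ : ⟨_⟩ → ⟨_⟩ → Set (lsuc 𝓥 ⊔ 𝓤 ⊔ 𝓣)
    x ≪ y = (I : Set 𝓥) (α : I → ⟨_⟩) (δ : is-directed _⊑_ α)
          → y ⊑ ∐ α δ → ∥ Σ[ i ∈ I ] (x ⊑ α i) ∥

    is-compact : ⟨_⟩ → Set (lsuc 𝓥 ⊔ 𝓤 ⊔ 𝓣)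
    is-compact x = x ≪ x

    ↓ᴮ : {B : Set 𝓥} (β : B → ⟨_⟩) (x : ⟨_⟩) → (Σ[ b ∈ B ] (β b ⊑ x)) → ⟨_⟩
    ↓ᴮ β x (b , _) = β b

    is-small-compact-basis : {B : Set 𝓥} → (B → ⟨_⟩) → Set (lsuc 𝓥 ⊔ 𝓤 ⊔ 𝓣)
    is-small-compact-basis {B} β =
      ((b : B) → is-compact (β b)) ×
      ((x : ⟨_⟩) → is-directed _⊑_ (↓ᴮ β x)) ×
      ((x : ⟨_⟩) → is-sup _⊑_ x (↓ᴮ β x)) ×
      ((x : ⟨_⟩) (b : B) → is-small (β b ⊑ x) 𝓥)

    has-specified-small-compact-basis : Set (lsuc 𝓥 ⊔ 𝓤 ⊔ 𝓣)
    has-specified-small-compact-basis =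
      Σ[ B ∈ Set 𝓥 ] Σ[ β ∈ (B → ⟨_⟩) ] is-small-compact-basis β

    has-unspecified-small-compact-basis : Set (lsuc 𝓥 ⊔ 𝓤 ⊔ 𝓣)
    has-unspecified-small-compact-basis = ∥ has-specified-small-compact-basis ∥

{-# OPTIONS --without-K #-}
module Submission where

-- If D has a small compact basis β, then every compact element of D lies in the image of β
-- (approximate it by basis elements below it), and the order of D is small, so D is locally
-- small and set replacement makes the type K of compact elements small.  Under univalence
-- smallness of a set is a proposition, so a small copy Y ≃ K can be extracted from a mere
-- existence of a basis.  The inclusion Y → D is itself a small compact basis, and being a small
-- compact basis is a proposition, so this too can be verified using the truncated basis.

open import Defs
open import Agda.Primitive using (Level; lsuc; _⊔_)
open import Data.Product using (Σ; _×_; _,_; proj₁; proj₂)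
open import Function using (_∘_)
open import Relation.Binary.PropositionalEquality using (_≡_; refl; sym; trans; cong; cong₂; subst)
open import Axiom.UniquenessOfIdentityProofs using (module Constant⇒UIP)

private
  variable
    a b c : Level
    A : Set a
    B : Set b
    C : Set c

⌜_⌝ : A ≃ B → A → B
⌜ e ⌝ = proj₁ e

⌜_⌝⁻¹ : A ≃ B → B → A
⌜ e ⌝⁻¹ = proj₁ (proj₁ (proj₂ e))

⌜⌝⁻¹-inverseʳ : (e : A ≃ B) (y : B) → ⌜ e ⌝ (⌜ e ⌝⁻¹ y) ≡ y
⌜⌝⁻¹-inverseʳ e = proj₂ (proj₁ (proj₂ e))

section≗retraction : (f : A → B) (s r : B → A)
                   → (∀ y → f (s y) ≡ y) → (∀ x → r (f x) ≡ x) → ∀ y → s y ≡ r y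
section≗retraction f s r ε η y = trans (sym (η (s y))) (cong r (ε y))

⌜⌝⁻¹-inverseˡ : (e : A ≃ B) (x : A) → ⌜ e ⌝⁻¹ (⌜ e ⌝ x) ≡ x
⌜⌝⁻¹-inverseˡ (f , (g , ε) , (h , η)) x = trans (section≗retraction f g h ε η (f x)) (η x)

qinv→≃ : (f : A → B) (g : B → A) → (∀ x → g (f x) ≡ x) → (∀ y → f (g y) ≡ y) → A ≃ B
qinv→≃ f g η ε = f , (g , ε) , (g , η)

≃-sym : A ≃ B → B ≃ A
≃-sym e = qinv→≃ ⌜ e ⌝⁻¹ ⌜ e ⌝ (⌜⌝⁻¹-inverseʳ e) (⌜⌝⁻¹-inverseˡ e)

≃-trans : A ≃ B → B ≃ C → A ≃ C
≃-trans e e' =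
  qinv→≃ (⌜ e' ⌝ ∘ ⌜ e ⌝) (⌜ e ⌝⁻¹ ∘ ⌜ e' ⌝⁻¹)
    (λ x → trans (cong ⌜ e ⌝⁻¹ (⌜⌝⁻¹-inverseˡ e' (⌜ e ⌝ x))) (⌜⌝⁻¹-inverseˡ e x))
    (λ z → trans (cong ⌜ e' ⌝ (⌜⌝⁻¹-inverseʳ e (⌜ e' ⌝⁻¹ z))) (⌜⌝⁻¹-inverseʳ e' z))

↔-props→≃ : is-prop A → is-prop B → A ↔ B → A ≃ B
↔-props→≃ pA pB (f , g) = qinv→≃ f g (λ _ → pA _ _) (λ _ → pB _ _)

≃-is-prop : A ≃ B → is-prop B → is-prop A
≃-is-prop e pB x y =
  trans (sym (⌜⌝⁻¹-inverseˡ e x)) (trans (cong ⌜ e ⌝⁻¹ (pB _ _)) (⌜⌝⁻¹-inverseˡ e y))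

×-is-prop : is-prop A → is-prop B → is-prop (A × B)
×-is-prop pA pB (x , y) (x' , y') with pA x x' | pB y y'
... | refl | refl = refl

Σ-≡-prop : {P : A → Set b} → ((x : A) → is-prop (P x))
         → {x y : A} → x ≡ y → (u : P x) (v : P y) → _≡_ {A = Σ A P} (x , u) (y , v)
Σ-≡-prop pP refl u v = cong (_ ,_) (pP _ u v)

prop→is-set : is-prop A → is-set A
prop→is-set pA x y = Constant⇒UIP.≡-irrelevant (λ {x′ y′} _ → pA x′ y′) (λ _ _ → refl)

-- back ∘ cong h is constant on each path type since B is a set; Hedberg's argument then applies.
left-cancellable-into-set→is-set : (h : A → B) → is-set B
                                 → (∀ {x y} → h x ≡ h y → x ≡ y) → is-set A
left-cancellable-into-set→is-set h sB back x y =
  Constant⇒UIP.≡-irrelevant (back ∘ cong h) (λ p q → cong back (sB _ _ (cong h p) (cong h q)))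

≃-is-set : A ≃ B → is-set B → is-set A
≃-is-set e sB = left-cancellable-into-set→is-set ⌜ e ⌝ sB
  λ {x} {y} p → trans (sym (⌜⌝⁻¹-inverseˡ e x)) (trans (cong ⌜ e ⌝⁻¹ p) (⌜⌝⁻¹-inverseˡ e y))

Σ-is-set : {P : A → Set b} → is-set A → ((x : A) → is-prop (P x)) → is-set (Σ A P)
Σ-is-set sA pP = left-cancellable-into-set→is-set proj₁ sA (λ p → Σ-≡-prop pP p _ _)

module Univalent (univalence : Univalence) where

  ua : {X Y : Set a} → X ≃ Y → X ≡ Y
  ua {X = X} {Y} = proj₁ (proj₁ (univalence X Y))

  idtoeqv-ua : {X Y : Set a} (e : X ≃ Y) → idtoeqv (ua e) ≡ e
  idtoeqv-ua {X = X} {Y} = proj₂ (proj₁ (univalence X Y))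

  precomp-equiv-injective : {X Y : Set a} (e : X ≃ Y) {Q : Y → Set b} (φ ψ : (y : Y) → Q y)
                          → (λ x → φ (⌜ e ⌝ x)) ≡ (λ x → ψ (⌜ e ⌝ x)) → φ ≡ ψ
  precomp-equiv-injective {X = X} {Y} e φ ψ =
    subst (λ f → (λ x → φ (f x)) ≡ (λ x → ψ (f x)) → φ ≡ ψ)
          (cong ⌜_⌝ (idtoeqv-ua e)) (for-idtoeqv (ua e))
    where
      for-idtoeqv : (p : X ≡ Y) → (λ x → φ (⌜ idtoeqv p ⌝ x)) ≡ (λ x → ψ (⌜ idtoeqv p ⌝ x)) → φ ≡ ψ
      for-idtoeqv refl r = r

  -- The diagonal into the type of triples (x , u , v , u ≡ v) is an equivalence, and the two
  -- projections to u and to v agree after precomposing with it; so they are equal, and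
  -- evaluating them at (x , f x , g x , h x) gives f ≡ g.
  funext : {P : A → Set b} {f g : (x : A) → P x} → ((x : A) → f x ≡ g x) → f ≡ g
  funext {A = A} {P = P} {f} {g} h =
    cong (λ k x → k (x , f x , g x , h x)) (precomp-equiv-injective diagonal-≃ left right refl)
    where
      Paths : Set _
      Paths = Σ A λ x → Σ (P x) λ u → Σ (P x) λ v → u ≡ v
      diagonal-≃ : Σ A P ≃ Paths
      diagonal-≃ = qinv→≃ (λ { (x , u) → x , u , u , refl }) (λ { (x , u , _) → x , u })
                          (λ _ → refl) (λ { (_ , _ , _ , refl) → refl })
      left right : (t : Paths) → P (proj₁ t)
      left (_ , u , _) = u
      right (_ , _ , v , _) = v

  Π-is-prop : {P : A → Set b} → ((x : A) → is-prop (P x)) → is-prop ((x : A) → P x)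
  Π-is-prop pP f g = funext λ x → pP x (f x) (g x)

  is-equiv-is-prop : (f : A → B) → is-set A → is-set B → is-prop (is-equiv f)
  is-equiv-is-prop f sA sB ((g , ε) , (h , η)) ((g' , ε') , (h' , η')) =
    cong₂ _,_ (Σ-≡-prop (λ _ → Π-is-prop λ _ → sB _ _) (funext g≗g') ε ε')
              (Σ-≡-prop (λ _ → Π-is-prop λ _ → sA _ _) (funext h≗h') η η')
    where
      g≗g' : ∀ y → g y ≡ g' y
      g≗g' y = trans (section≗retraction f g h ε η y) (sym (section≗retraction f g' h ε' η y))
      h≗h' : ∀ y → h y ≡ h' y
      h≗h' y = trans (sym (section≗retraction f g h ε η y)) (trans (g≗g' y) (section≗retraction f g' h' ε' η' y))

  is-small-is-prop : (𝓥 : Level) → is-set A → is-prop (is-small A 𝓥)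
  is-small-is-prop {A = A} 𝓥 sA (Y , e) (Y' , e') = transport-small (ua Y≃Y') e e' agrees (≃-is-set e sA)
    where
      Y≃Y' : Y ≃ Y'
      Y≃Y' = ≃-trans e (≃-sym e')
      transport-small : (p : Y ≡ Y') (e : Y ≃ A) (e' : Y' ≃ A)
                      → (∀ y → ⌜ e' ⌝ (⌜ idtoeqv p ⌝ y) ≡ ⌜ e ⌝ y) → is-set Y
                      → _≡_ {A = is-small A 𝓥} (Y , e) (Y' , e')
      transport-small refl e e' agrees sY =
        cong (_ ,_) (Σ-≡-prop (λ f → is-equiv-is-prop f sY sA) (funext (sym ∘ agrees)) _ _)
      agrees : ∀ y → ⌜ e' ⌝ (⌜ idtoeqv (ua Y≃Y') ⌝ y) ≡ ⌜ e ⌝ y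
      agrees y = trans (cong (λ d → ⌜ e' ⌝ (⌜ d ⌝ y)) (idtoeqv-ua Y≃Y'))
                       (⌜⌝⁻¹-inverseʳ e' (⌜ e ⌝ y))

module CompactElements (pt : PropTrunc) (univalence : Univalence)
                       {𝓥 𝓤 𝓣 : Level} (D : DCPO pt 𝓥 𝓤 𝓣) where
  open PropTrunc pt
  open DCPO D
  open Univalent univalence

  ∥∥-map : (A → B) → ∥ A ∥ → ∥ B ∥
  ∥∥-map f = ∥∥-rec ∥∥-is-prop (∣_∣ ∘ f)

  ∥∥-bind : ∥ A ∥ → (A → ∥ B ∥) → ∥ B ∥
  ∥∥-bind t f = ∥∥-rec ∥∥-is-prop f t

  is-compact-is-prop : (x : ⟨_⟩) → is-prop (is-compact pt D x)
  is-compact-is-prop x = Π-is-prop λ _ → Π-is-prop λ _ → Π-is-prop λ _ → Π-is-prop λ _ → ∥∥-is-prop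

  K : Set (lsuc 𝓥 ⊔ 𝓤 ⊔ 𝓣)
  K = Σ ⟨_⟩ (is-compact pt D)

  K-is-set : is-set K
  K-is-set = Σ-is-set carrier-is-set is-compact-is-prop

  is-small-compact-basis-is-prop : {B : Set 𝓥} (β : B → ⟨_⟩) → is-prop (is-small-compact-basis pt D β)
  is-small-compact-basis-is-prop β =
    ×-is-prop (Π-is-prop λ b → is-compact-is-prop (β b)) (×-is-prop
      (Π-is-prop λ _ → ×-is-prop ∥∥-is-prop (Π-is-prop λ _ → Π-is-prop λ _ → ∥∥-is-prop)) (×-is-prop
      (Π-is-prop λ _ → ×-is-prop (Π-is-prop λ _ → ⊑-prop-valued _ _)
                                 (Π-is-prop λ _ → Π-is-prop λ _ → ⊑-prop-valued _ _))
      (Π-is-prop λ x → Π-is-prop λ b → is-small-is-prop 𝓥 (prop→is-set (⊑-prop-valued (β b) x)))))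

  module _ {B : Set 𝓥} (β : B → ⟨_⟩) (basis : is-small-compact-basis pt D β) where
    private
      β-compact : (b : B) → is-compact pt D (β b)
      β-compact = proj₁ basis
      ↓ᴮ-directed : (x : ⟨_⟩) → is-directed pt _⊑_ (↓ᴮ pt D β x)
      ↓ᴮ-directed = proj₁ (proj₂ basis)
      ↓ᴮ-sup : (x : ⟨_⟩) → is-sup pt _⊑_ x (↓ᴮ pt D β x)
      ↓ᴮ-sup = proj₁ (proj₂ (proj₂ basis))
      ⊑-small : (x : ⟨_⟩) (b : B) → is-small (β b ⊑ x) 𝓥
      ⊑-small = proj₂ (proj₂ (proj₂ basis))

    _⊑ₛ_ : B → ⟨_⟩ → Set 𝓥
    b ⊑ₛ x = proj₁ (⊑-small x b)

    ⊑ₛ≃⊑ : (b : B) (x : ⟨_⟩) → (b ⊑ₛ x) ≃ (β b ⊑ x)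
    ⊑ₛ≃⊑ b x = proj₂ (⊑-small x b)

    ⊑ₛ-is-prop : (b : B) (x : ⟨_⟩) → is-prop (b ⊑ₛ x)
    ⊑ₛ-is-prop b x = ≃-is-prop (⊑ₛ≃⊑ b x) (⊑-prop-valued _ _)

    ↓ₛ : (x : ⟨_⟩) → Σ B (_⊑ₛ x) → ⟨_⟩
    ↓ₛ x (b , _) = β b

    ↓ₛ-directed : (x : ⟨_⟩) → is-directed pt _⊑_ (↓ₛ x)
    ↓ₛ-directed x = ∥∥-map small (proj₁ (↓ᴮ-directed x)) , upper-bounds
      where
        small : Σ B (λ b → β b ⊑ x) → Σ B (_⊑ₛ x)
        small (b , le) = b , ⌜ ⊑ₛ≃⊑ b x ⌝⁻¹ le
        upper-bounds : (i j : Σ B (_⊑ₛ x))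
                     → ∥ Σ (Σ B (_⊑ₛ x)) (λ k → (↓ₛ x i ⊑ ↓ₛ x k) × (↓ₛ x j ⊑ ↓ₛ x k)) ∥
        upper-bounds (b₁ , s₁) (b₂ , s₂) =
          ∥∥-map (λ { (k , k₁ , k₂) → small k , k₁ , k₂ })
                 (proj₂ (↓ᴮ-directed x) (b₁ , ⌜ ⊑ₛ≃⊑ b₁ x ⌝ s₁) (b₂ , ⌜ ⊑ₛ≃⊑ b₂ x ⌝ s₂))

    ⊑-∐-↓ₛ : (x : ⟨_⟩) → x ⊑ ∐ (↓ₛ x) (↓ₛ-directed x)
    ⊑-∐-↓ₛ x = proj₂ (↓ᴮ-sup x) _ λ { (b , le) →
      proj₁ (∐-is-sup (↓ₛ x) (↓ₛ-directed x)) (b , ⌜ ⊑ₛ≃⊑ b x ⌝⁻¹ le) }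

    compact-interpolated-by-basis : (c x : ⟨_⟩) → is-compact pt D c → c ⊑ x
                                  → ∥ Σ B (λ b → (c ⊑ β b) × (β b ⊑ x)) ∥
    compact-interpolated-by-basis c x c-compact c⊑x =
      ∥∥-map (λ { ((b , s) , c⊑βb) → b , c⊑βb , ⌜ ⊑ₛ≃⊑ b x ⌝ s })
             (c-compact _ (↓ₛ x) (↓ₛ-directed x) (⊑-trans _ _ _ c⊑x (⊑-∐-↓ₛ x)))

    ⊑-is-small : (x y : ⟨_⟩) → is-small (x ⊑ y) 𝓥
    ⊑-is-small x y = ((b : B) → b ⊑ₛ x → b ⊑ₛ y) ,
      ↔-props→≃ (Π-is-prop λ b → Π-is-prop λ _ → ⊑ₛ-is-prop b y) (⊑-prop-valued x y)
        ( (λ h → proj₂ (↓ᴮ-sup x) y λ { (b , le) → ⌜ ⊑ₛ≃⊑ b y ⌝ (h b (⌜ ⊑ₛ≃⊑ b x ⌝⁻¹ le)) })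
        , (λ x⊑y b s → ⌜ ⊑ₛ≃⊑ b y ⌝⁻¹ (⊑-trans _ _ _ (⌜ ⊑ₛ≃⊑ b x ⌝ s) x⊑y)) )

    carrier-is-locally-small : is-locally-small ⟨_⟩ 𝓥
    carrier-is-locally-small x y = (proj₁ (⊑-is-small x y) × proj₁ (⊑-is-small y x)) ,
      ↔-props→≃ (×-is-prop (≃-is-prop (e x y) (⊑-prop-valued x y)) (≃-is-prop (e y x) (⊑-prop-valued y x)))
                (carrier-is-set x y)
        ( (λ { (s , t) → ⊑-antisym x y (⌜ e x y ⌝ s) (⌜ e y x ⌝ t) })
        , (λ { refl → ⌜ e x x ⌝⁻¹ (⊑-refl x) , ⌜ e x x ⌝⁻¹ (⊑-refl x) }) )
      where
        e : (x y : ⟨_⟩) → proj₁ (⊑-is-small x y) ≃ (x ⊑ y)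
        e x y = proj₂ (⊑-is-small x y)

    image-≃-K : image pt β ≃ K
    image-≃-K = qinv→≃ to from (λ { (x , _) → cong (x ,_) (∥∥-is-prop _ _) })
                                (λ { (x , _) → cong (x ,_) (is-compact-is-prop x _ _) })
      where
        to : image pt β → K
        to (x , t) = x , ∥∥-rec (is-compact-is-prop x) (λ { (b , refl) → β-compact b }) t
        from : K → image pt β
        from (x , x-compact) = x ,
          ∥∥-map (λ { (b , x⊑βb , βb⊑x) → b , ⊑-antisym (β b) x βb⊑x x⊑βb })
                 (compact-interpolated-by-basis x x x-compact (⊑-refl x))

    K-is-small : SetReplacement pt → is-small K 𝓥
    K-is-small replacement =
      let (Y , Y≃image) = replacement β (B , id-≃ B) carrier-is-locally-small carrier-is-set
      in  Y , ≃-trans Y≃image image-≃-K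

    module _ (Y : Set 𝓥) (e : Y ≃ K) where
      βY : Y → ⟨_⟩
      βY = proj₁ ∘ ⌜ e ⌝

      index-of-basis : (b : B) → Σ Y λ y → βY y ≡ β b
      index-of-basis b = ⌜ e ⌝⁻¹ (β b , β-compact b) , cong proj₁ (⌜⌝⁻¹-inverseʳ e (β b , β-compact b))

      ↓ᴮ-βY-directed : (x : ⟨_⟩) → is-directed pt _⊑_ (↓ᴮ pt D βY x)
      ↓ᴮ-βY-directed x = ∥∥-map (λ { (b , βb⊑x) → lift b βb⊑x }) (proj₁ (↓ᴮ-directed x)) , upper-bounds
        where
          lift : (b : B) → β b ⊑ x → Σ Y (λ y → βY y ⊑ x)
          lift b βb⊑x = proj₁ (index-of-basis b) , subst (_⊑ x) (sym (proj₂ (index-of-basis b))) βb⊑x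
          below-lift : {z : ⟨_⟩} (b : B) (βb⊑x : β b ⊑ x) → z ⊑ β b → z ⊑ βY (proj₁ (lift b βb⊑x))
          below-lift {z} b _ = subst (z ⊑_) (sym (proj₂ (index-of-basis b)))
          upper-bounds : (i j : Σ Y (λ y → βY y ⊑ x))
                       → ∥ Σ (Σ Y (λ y → βY y ⊑ x))
                             (λ k → (↓ᴮ pt D βY x i ⊑ ↓ᴮ pt D βY x k) × (↓ᴮ pt D βY x j ⊑ ↓ᴮ pt D βY x k)) ∥
          upper-bounds (y₁ , y₁⊑x) (y₂ , y₂⊑x) =
            ∥∥-bind (compact-interpolated-by-basis (βY y₁) x (proj₂ (⌜ e ⌝ y₁)) y₁⊑x) λ { (b₁ , y₁⊑b₁ , b₁⊑x) →
            ∥∥-bind (compact-interpolated-by-basis (βY y₂) x (proj₂ (⌜ e ⌝ y₂)) y₂⊑x) λ { (b₂ , y₂⊑b₂ , b₂⊑x) →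
            ∥∥-map (λ { ((k , k⊑x) , b₁⊑k , b₂⊑k) →
                          lift k k⊑x
                        , below-lift k k⊑x (⊑-trans _ _ _ y₁⊑b₁ b₁⊑k)
                        , below-lift k k⊑x (⊑-trans _ _ _ y₂⊑b₂ b₂⊑k) })
                   (proj₂ (↓ᴮ-directed x) (b₁ , b₁⊑x) (b₂ , b₂⊑x)) } }

      ↓ᴮ-βY-sup : (x : ⟨_⟩) → is-sup pt _⊑_ x (↓ᴮ pt D βY x)
      ↓ᴮ-βY-sup x = proj₂ , λ u u-ub → proj₂ (↓ᴮ-sup x) u λ { (b , βb⊑x) →
        let (y , βy≡βb) = index-of-basis b
        in  subst (_⊑ u) βy≡βb (u-ub (y , subst (_⊑ x) (sym βy≡βb) βb⊑x)) }

      K-copy-is-small-compact-basis : is-small-compact-basis pt D βY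
      K-copy-is-small-compact-basis =
        (proj₂ ∘ ⌜ e ⌝) , ↓ᴮ-βY-directed , ↓ᴮ-βY-sup , λ x y → ⊑-is-small (βY y) x

  has-unspecified-basis→K-is-small : SetReplacement pt → has-unspecified-small-compact-basis pt D
                                   → is-small K 𝓥
  has-unspecified-basis→K-is-small replacement =
    ∥∥-rec (is-small-is-prop 𝓥 K-is-set) λ { (_ , β , basis) → K-is-small β basis replacement }

  has-unspecified-basis→has-specified-basis : SetReplacement pt
    → has-unspecified-small-compact-basis pt D → has-specified-small-compact-basis pt D
  has-unspecified-basis→has-specified-basis replacement t =
    let (Y , e) = has-unspecified-basis→K-is-small replacement t
    in  Y , proj₁ ∘ ⌜ e ⌝ , ∥∥-rec (is-small-compact-basis-is-prop (proj₁ ∘ ⌜ e ⌝))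
                                    (λ { (_ , β , basis) → K-copy-is-small-compact-basis β basis Y e }) t

proposition5p24 : (pt : PropTrunc) → Univalence → SetReplacement pt
    → ∀ {𝓥 𝓤 𝓣} (D : DCPO pt 𝓥 𝓤 𝓣)
    → has-specified-small-compact-basis pt D ↔ has-unspecified-small-compact-basis pt D
proposition5p24 pt univalence replacement D =
  PropTrunc.∣_∣ pt , CompactElements.has-unspecified-basis→has-specified-basis pt univalence D replacement
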